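{- Let $\Gamma$ be a finite digraph, $A$ an atom of $\Gamma$ and $B$ a part of $\Gamma$. If $A\cap B$ and $A\setminus B$ are both non-empty, then $|N(A)\setminus(B\cup N(B))|<|N(B)\cap A|$.
   Context: For a digraph $\Gamma$ and $A\subseteq V(\Gamma)$, $N(A)=\{x\in V(\Gamma)\setminus A : \exists y\in A,\ (y,x)\in E(\Gamma)\}$. A set $A\subseteq V(\Gamma)$ is a part of $\Gamma$ if $V(\Gamma)\setminus(A\cup N(A))$ is non-empty. The vertex connectivity $\kappa$ of $\Gamma$ is the smallest number of vertices whose removal leaves a digraph that is not strongly connected. An atom of $\Gamma$ is a part $A$ with $|N(A)|=\kappa$ of minimum size among all parts with this property. -}

module Defs where

open import Data.Nat using (ℕ; _≤_)
open import Data.Bool using (Bool; true; not; _∧_)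
open import Data.Fin using (Fin)
open import Data.Fin.Subset using (Subset; _∈_; _∉_; ∁; _∪_; Nonempty; ∣_∣)
open import Data.Vec using (tabulate; lookup)
open import Data.List using (allFin)
open import Data.Bool.ListAction using (any)
open import Data.Product using (_×_; ∃; ∃-syntax; Σ-syntax)
open import Relation.Binary.PropositionalEquality using (_≡_)
open import Relation.Nullary using (¬_)

-- A finite digraph on the vertex set Fin n, given by its (Boolean) arc relation:
-- (y , x) is an arc iff  E y x ≡ true.  Loops are allowed (they are irrelevant here).
Digraph : ℕ → Set
Digraph n = Fin n → Fin n → Bool

module _ {n : ℕ} (Γ : Digraph n) where

  N : Subset n → Subset n
  N A = tabulate λ x → not (lookup A x) ∧ any (λ y → lookup A y ∧ Γ y x) (allFin n)

  Part : Subset n → Set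
  Part A = Nonempty (∁ (A ∪ N A))

  data Reach (S : Subset n) : Fin n → Fin n → Set where
    here : ∀ {u} → u ∉ S → Reach S u u
    step : ∀ {u w v} → u ∉ S → Γ u w ≡ true → Reach S w v → Reach S u v

  StronglyConnectedAfterRemoving : Subset n → Set
  StronglyConnectedAfterRemoving S = ∀ u v → u ∉ S → v ∉ S → Reach S u v

  IsConnectivity : ℕ → Set
  IsConnectivity k =
    (∃[ S ] (∣ S ∣ ≡ k × ¬ StronglyConnectedAfterRemoving S))
    × (∀ S → ¬ StronglyConnectedAfterRemoving S → k ≤ ∣ S ∣)

  IsAtom : ℕ → Subset n → Set
  IsAtom k A = Part A × ∣ N A ∣ ≡ k × (∀ B → Part B → ∣ N B ∣ ≡ k → ∣ A ∣ ≤ ∣ B ∣)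

-- Put C = A ∩ B.  C is a non-empty part (it lies in the part B), so N(C)
-- separates Γ and |N(C)| ≥ κ = |N(A)|; equality would contradict the
-- minimality of the atom A, because C ⊊ A (A ∖ B ≠ ∅).  Hence |N(A)| < |N(C)|.
-- On the other hand every vertex of N(C) lies in N(B) ∩ A or in N(A) ∩ (B ∪ N(B)),
-- so |N(C)| ≤ |N(B) ∩ A| + |N(A)| − |N(A) ∖ (B ∪ N(B))|.
module Submission where

open import Defs
open import Data.Nat using (ℕ; _<_; _≤_; _+_; suc; z≤n; s≤s)
open import Data.Nat.Properties
  using (+-suc; +-comm; ≤-trans; n≤1+n; +-monoʳ-≤; ≤∧≢⇒<; <⇒≱; +-cancelˡ-<; module ≤-Reasoning)
open import Data.Bool using (T; true; false; not; _∧_)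
open import Data.Bool.ListAction using (any)
open import Data.Bool.Properties using (T-≡; T-∧; T-not-≡)
open import Data.Fin using (Fin)
open import Data.Fin.Subset
  using (Subset; inside; outside; _∈_; _∉_; _⊆_; _⊂_; _∩_; _∪_; _─_; Nonempty; ∣_∣)
open import Data.Fin.Subset.Properties
  using ( _∈?_; p⊆q⇒∣p∣≤∣q∣; p⊂q⇒∣p∣<∣q∣; p∩q⊆p; p∩q⊆q; x∈p∩q⁺; x∈p∩q⁻; x∈p∪q⁺; x∈p∪q⁻
        ; p─q⊆p; x∈∁p⇒x∉p; x∉p⇒x∈∁p)
open import Data.Vec using ([]; _∷_; here; there; lookup)
open import Data.Vec.Properties using (lookup∘tabulate; []=⇒lookup; lookup⇒[]=)
open import Data.List using (allFin)
open import Data.List.Relation.Unary.Any using (satisfied)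
open import Data.List.Membership.Propositional using (lose)
open import Data.List.Relation.Unary.Any.Properties using (any⁺; any⁻)
open import Data.List.Membership.Propositional.Properties using (∈-allFin)
open import Data.Product using (_×_; _,_; proj₁; proj₂; ∃-syntax)
open import Data.Sum using (inj₁; inj₂)
open import Function using (_∘_)
open import Function.Bundles using (Equivalence)
open import Relation.Nullary using (¬_; yes; no; contradiction)
open import Relation.Binary.PropositionalEquality using (_≡_; _≢_; refl; sym; trans; cong; subst)

open Equivalence using (to; from)

∣p∪q∣≤∣p∣+∣q∣ : ∀ {n} (p q : Subset n) → ∣ p ∪ q ∣ ≤ ∣ p ∣ + ∣ q ∣
∣p∪q∣≤∣p∣+∣q∣ []            []            = z≤n
∣p∪q∣≤∣p∣+∣q∣ (inside  ∷ p) (inside  ∷ q) =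
  s≤s (≤-trans (∣p∪q∣≤∣p∣+∣q∣ p q) (+-monoʳ-≤ ∣ p ∣ (n≤1+n ∣ q ∣)))
∣p∪q∣≤∣p∣+∣q∣ (inside  ∷ p) (outside ∷ q) = s≤s (∣p∪q∣≤∣p∣+∣q∣ p q)
∣p∪q∣≤∣p∣+∣q∣ (outside ∷ p) (inside  ∷ q) =
  subst (suc ∣ p ∪ q ∣ ≤_) (sym (+-suc ∣ p ∣ ∣ q ∣)) (s≤s (∣p∪q∣≤∣p∣+∣q∣ p q))
∣p∪q∣≤∣p∣+∣q∣ (outside ∷ p) (outside ∷ q) = ∣p∪q∣≤∣p∣+∣q∣ p q

∣p∩q∣+∣p─q∣≡∣p∣ : ∀ {n} (p q : Subset n) → ∣ p ∩ q ∣ + ∣ p ─ q ∣ ≡ ∣ p ∣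
∣p∩q∣+∣p─q∣≡∣p∣ []            []            = refl
∣p∩q∣+∣p─q∣≡∣p∣ (inside  ∷ p) (inside  ∷ q) = cong suc (∣p∩q∣+∣p─q∣≡∣p∣ p q)
∣p∩q∣+∣p─q∣≡∣p∣ (inside  ∷ p) (outside ∷ q) =
  trans (+-suc ∣ p ∩ q ∣ ∣ p ─ q ∣) (cong suc (∣p∩q∣+∣p─q∣≡∣p∣ p q))
∣p∩q∣+∣p─q∣≡∣p∣ (outside ∷ p) (inside  ∷ q) = ∣p∩q∣+∣p─q∣≡∣p∣ p q
∣p∩q∣+∣p─q∣≡∣p∣ (outside ∷ p) (outside ∷ q) = ∣p∩q∣+∣p─q∣≡∣p∣ p q

∉⇒lookup≡false : ∀ {n} {x : Fin n} (p : Subset n) → x ∉ p → lookup p x ≡ false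
∉⇒lookup≡false {x = x} p x∉p with lookup p x in eq
... | false = refl
... | true  = contradiction (lookup⇒[]= x p eq) x∉p

x∈p─q⇒x∉q : ∀ {n} {x : Fin n} (p q : Subset n) → x ∈ p ─ q → x ∉ q
x∈p─q⇒x∉q (_ ∷ _) (inside ∷ _) () here
x∈p─q⇒x∉q (_ ∷ p) (_ ∷ q) (there x∈p─q) (there x∈q) = x∈p─q⇒x∉q p q x∈p─q x∈q

module _ {n : ℕ} (Γ : Digraph n) where

  private
    variable
      P Q : Subset n
      u v x y : Fin n
      κ : ℕ
      A C : Subset n

  lookup-N : ∀ P x → lookup (N Γ P) x ≡ not (lookup P x) ∧ any (λ y → lookup P y ∧ Γ y x) (allFin n)
  lookup-N P = lookup∘tabulate _

  x∈N⁻ : x ∈ N Γ P → x ∉ P × ∃[ y ] (y ∈ P × Γ y x ≡ true)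
  x∈N⁻ {x = x} {P = P} x∈NP
    with to T-∧ (from T-≡ (trans (sym (lookup-N P x)) ([]=⇒lookup x∈NP)))
  ... | T¬Px , T∃y with satisfied (any⁻ _ (allFin n) T∃y)
  ... | y , TPy∧Γyx with to T-∧ TPy∧Γyx
  ... | TPy , TΓyx = x∉P , y , lookup⇒[]= y P (to T-≡ TPy) , to T-≡ TΓyx
    where
    x∉P : x ∉ P
    x∉P x∈P = subst T (to T-not-≡ T¬Px) (from T-≡ ([]=⇒lookup x∈P))

  x∈N⁺ : x ∉ P → y ∈ P → Γ y x ≡ true → x ∈ N Γ P
  x∈N⁺ {x = x} {P = P} {y = y} x∉P y∈P Γyx =
    lookup⇒[]= x (N Γ P) (trans (lookup-N P x) (to T-≡ T¬Px∧∃y))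
    where
    T¬Px∧∃y : T (not (lookup P x) ∧ any (λ y → lookup P y ∧ Γ y x) (allFin n))
    T¬Px∧∃y = from T-∧
      ( from T-not-≡ (∉⇒lookup≡false P x∉P)
      , any⁺ _ (lose (∈-allFin y) (from T-∧ (from T-≡ ([]=⇒lookup y∈P) , from T-≡ Γyx))))

  N-disjoint : x ∈ N Γ P → x ∉ P
  N-disjoint x∈NP = proj₁ (x∈N⁻ x∈NP)

  N⊆∪N : P ⊆ Q → N Γ P ⊆ Q ∪ N Γ Q
  N⊆∪N {P = P} {Q = Q} P⊆Q {x} x∈NP with x ∈? Q | x∈N⁻ x∈NP
  ... | yes x∈Q | _                = x∈p∪q⁺ (inj₁ x∈Q)
  ... | no  x∉Q | _ , y , y∈P , Γyx = x∈p∪q⁺ (inj₂ (x∈N⁺ x∉Q (P⊆Q y∈P) Γyx))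

  ∪N-mono : P ⊆ Q → P ∪ N Γ P ⊆ Q ∪ N Γ Q
  ∪N-mono {P = P} P⊆Q x∈P∪NP with x∈p∪q⁻ P (N Γ P) x∈P∪NP
  ... | inj₁ x∈P  = x∈p∪q⁺ (inj₁ (P⊆Q x∈P))
  ... | inj₂ x∈NP = N⊆∪N P⊆Q x∈NP

  x∈∪N∧x∉⇒x∈N : x ∈ P ∪ N Γ P → x ∉ P → x ∈ N Γ P
  x∈∪N∧x∉⇒x∈N {P = P} x∈P∪NP x∉P with x∈p∪q⁻ P (N Γ P) x∈P∪NP
  ... | inj₁ x∈P  = contradiction x∈P x∉P
  ... | inj₂ x∈NP = x∈NP

  Part-⊆ : P ⊆ Q → Part Γ Q → Part Γ P
  Part-⊆ P⊆Q (w , w∈∁Q∪NQ) = w , x∉p⇒x∈∁p (x∈∁p⇒x∉p w∈∁Q∪NQ ∘ ∪N-mono P⊆Q)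

  Reach-source-∉ : ∀ {S} → Reach Γ S u v → u ∉ S
  Reach-source-∉ (here u∉S)     = u∉S
  Reach-source-∉ (step u∉S _ _) = u∉S

  Reach-N-preserves-∈ : Reach Γ (N Γ P) u v → u ∈ P → v ∈ P
  Reach-N-preserves-∈ (here _) u∈P = u∈P
  Reach-N-preserves-∈ {P = P} (step {w = w} _ Γuw w↝v) u∈P with w ∈? P
  ... | yes w∈P = Reach-N-preserves-∈ w↝v w∈P
  ... | no  w∉P = contradiction (x∈N⁺ w∉P u∈P Γuw) (Reach-source-∉ w↝v)

  N-separates : Nonempty P → Part Γ P → ¬ StronglyConnectedAfterRemoving Γ (N Γ P)
  N-separates {P = P} (p , p∈P) (w , w∈∁P∪NP) strong = w∉P∪NP (x∈p∪q⁺ (inj₁ w∈P))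
    where
    w∉P∪NP = x∈∁p⇒x∉p w∈∁P∪NP
    p↝w = strong p w (λ p∈NP → N-disjoint p∈NP p∈P) (w∉P∪NP ∘ x∈p∪q⁺ ∘ inj₂)
    w∈P = Reach-N-preserves-∈ p↝w p∈P

  N-∩-⊆ : ∀ P Q → N Γ (P ∩ Q) ⊆ (N Γ Q ∩ P) ∪ (N Γ P ∩ (Q ∪ N Γ Q))
  N-∩-⊆ P Q {x} x∈NP∩Q with x ∈? P
  ... | yes x∈P = x∈p∪q⁺ (inj₁ (x∈p∩q⁺ (x∈∪N∧x∉⇒x∈N x∈Q∪NQ x∉Q , x∈P)))
    where
    x∈Q∪NQ = N⊆∪N (p∩q⊆q P Q) x∈NP∩Q
    x∉Q = λ x∈Q → N-disjoint x∈NP∩Q (x∈p∩q⁺ (x∈P , x∈Q))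
  ... | no  x∉P = x∈p∪q⁺ (inj₂ (x∈p∩q⁺ (x∈∪N∧x∉⇒x∈N x∈P∪NP x∉P , x∈Q∪NQ)))
    where
    x∈P∪NP = N⊆∪N (p∩q⊆p P Q) x∈NP∩Q
    x∈Q∪NQ = N⊆∪N (p∩q⊆q P Q) x∈NP∩Q

  atom-N-< : IsConnectivity Γ κ → IsAtom Γ κ A → Nonempty C → Part Γ C → C ⊂ A
           → ∣ N Γ A ∣ < ∣ N Γ C ∣
  atom-N-< {κ = κ} {A = A} {C = C} (_ , κ-min) (_ , ∣NA∣≡κ , A-min) C≢∅ partC C⊂A =
    subst (_< ∣ N Γ C ∣) (sym ∣NA∣≡κ) (≤∧≢⇒< (κ-min (N Γ C) (N-separates C≢∅ partC)) κ≢∣NC∣)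
    where
    κ≢∣NC∣ : κ ≢ ∣ N Γ C ∣
    κ≢∣NC∣ κ≡∣NC∣ = <⇒≱ (p⊂q⇒∣p∣<∣q∣ C⊂A) (A-min C partC (sym κ≡∣NC∣))

lemma6 : (n : ℕ) (Γ : Digraph n) (κ : ℕ) (A B : Subset n)
    → IsConnectivity Γ κ → IsAtom Γ κ A → Part Γ B
    → Nonempty (A ∩ B) → Nonempty (A ─ B)
    → ∣ N Γ A ─ (B ∪ N Γ B) ∣ < ∣ N Γ B ∩ A ∣
lemma6 _ Γ _ A B conn atom partB A∩B≢∅ (x , x∈A─B) =
  +-cancelˡ-< ∣ NA ∩ Y ∣ _ _ (begin-strict
    ∣ NA ∩ Y ∣ + ∣ NA ─ Y ∣          ≡⟨ ∣p∩q∣+∣p─q∣≡∣p∣ NA Y ⟩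
    ∣ NA ∣                           <⟨ atom-N-< Γ conn atom A∩B≢∅ partA∩B A∩B⊂A ⟩
    ∣ N Γ (A ∩ B) ∣                  ≤⟨ p⊆q⇒∣p∣≤∣q∣ (N-∩-⊆ Γ A B) ⟩
    ∣ (N Γ B ∩ A) ∪ (NA ∩ Y) ∣       ≤⟨ ∣p∪q∣≤∣p∣+∣q∣ (N Γ B ∩ A) (NA ∩ Y) ⟩
    ∣ N Γ B ∩ A ∣ + ∣ NA ∩ Y ∣       ≡⟨ +-comm (∣ N Γ B ∩ A ∣) _ ⟩
    ∣ NA ∩ Y ∣ + ∣ N Γ B ∩ A ∣       ∎)
  where
  open ≤-Reasoning
  NA = N Γ A
  Y  = B ∪ N Γ B
  partA∩B = Part-⊆ Γ (p∩q⊆q A B) partB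
  A∩B⊂A : A ∩ B ⊂ A
  A∩B⊂A = p∩q⊆p A B , x , p─q⊆p A B x∈A─B , x∈p─q⇒x∉q A B x∈A─B ∘ proj₂ ∘ x∈p∩q⁻ A B
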